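{- Let $B$ be a finite set of Boolean functions with $B\subseteq\mathsf{S}_0$. Then for every function $f\in[B]$, the solution graph $G(f)$ is connected, and for any two solutions $\boldsymbol a,\boldsymbol b$ of $f$, $d_f(\boldsymbol a,\boldsymbol b)\le|\boldsymbol a-\boldsymbol b|+2$.
   Context: For an $n$-ary Boolean function $f$, its solution graph $G(f)$ has vertex set $f^{ -1}(1)\subseteq\{0,1\}^n$ (the solutions), two vertices adjacent iff they differ in exactly one coordinate; an empty graph counts as connected. $d_f(\boldsymbol a,\boldsymbol b)$ is the shortest-path distance in $G(f)$, and $|\boldsymbol a-\boldsymbol b|$ is the Hamming distance. $[B]$ denotes the set of Boolean functions obtainable from $B$ and all projections by composition, permutation and identification of variables, and introduction of fictive variables. $\mathsf{S}_0$ is the set of $0$-separating functions: $f$ is $0$-separating if there exists an index $i$ such that $a_i=0$ for all $\boldsymbol a\in f^{ -1}(0)$. -}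

module Defs where

open import Data.Nat using (ℕ; zero; suc; _+_; _≤_)
open import Data.Bool using (Bool; true; false; _xor_; if_then_else_)
open import Data.Fin using (Fin)
open import Data.Vec using (Vec; []; _∷_; lookup; tabulate)
open import Data.List using (List)
open import Data.List.Membership.Propositional using (_∈_)
open import Data.Product using (Σ; ∃; _×_; _,_; proj₁; proj₂)
open import Relation.Binary.PropositionalEquality using (_≡_)

BoolFun : ℕ → Set
BoolFun n = Vec Bool n → Bool

AnyFun : Set
AnyFun = Σ ℕ BoolFun

ZeroSeparating : ∀ {n} → BoolFun n → Set
ZeroSeparating {n} f = Σ (Fin n) λ i → ∀ (a : Vec Bool n) → f a ≡ false → lookup a i ≡ false

-- The functions they denote are exactly the members of the clone [B]
-- (closure of B ∪ projections under composition, permutation/identification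
-- of variables, and introduction of fictive variables).
data Term (B : List AnyFun) (n : ℕ) : Set where
  var : Fin n → Term B n
  app : ∀ {k} {g : BoolFun k} → (k , g) ∈ B → (Fin k → Term B n) → Term B n

eval : ∀ {B n} → Term B n → BoolFun n
eval (var i) x = lookup x i
eval (app {g = g} _ ts) x = g (tabulate λ i → eval (ts i) x)

InClone : (B : List AnyFun) → ∀ {n} → BoolFun n → Set
InClone B {n} f = Σ (Term B n) λ t → ∀ x → f x ≡ eval t x

hamming : ∀ {n} → Vec Bool n → Vec Bool n → ℕ
hamming [] [] = 0
hamming (x ∷ xs) (y ∷ ys) = (if x xor y then 1 else 0) + hamming xs ys

Adjacent : ∀ {n} → Vec Bool n → Vec Bool n → Set
Adjacent a b = hamming a b ≡ 1

-- Walk f a b ℓ : a walk of length ℓ from a to b in G(f) whose vertices after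
-- the first are all solutions of f (the start vertex is assumed a solution).
data Walk {n} (f : BoolFun n) : Vec Bool n → Vec Bool n → ℕ → Set where
  here : ∀ {a} → Walk f a a 0
  step : ∀ {a c b ℓ} → Adjacent a c → f c ≡ true → Walk f c b ℓ → Walk f a b (suc ℓ)

Connected : ∀ {n} → BoolFun n → Set
Connected {n} f = ∀ (a b : Vec Bool n) → f a ≡ true → f b ≡ true → ∃ λ ℓ → Walk f a b ℓ

DistLe : ∀ {n} → BoolFun n → Vec Bool n → Vec Bool n → ℕ → Set
DistLe f a b m = ∃ λ ℓ → Walk f a b ℓ × ℓ ≤ m

module Submission where

-- A 0-separating function g with separating index j satisfies g ≥ x_j.
-- Substituting terms into g preserves "f ≥ x_i for some i" (take the i for
-- the j-th argument), so every f ∈ [B] is 1 on the subcube x_i = 1.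
-- That subcube contains, with any two of its points, every point between
-- them, so it is connected in G(f) with distances equal to Hamming distances.
-- Every a is at most one step from a[i := 1], and so is every solution b
-- from b[i := 1], which gives d_f(a,b) ≤ 1 + |a − b| + 1.

open import Defs
open import Data.Nat using (suc; _+_; _≤_; z≤n)
open import Data.Nat.Properties
  using (≤-refl; ≤-trans; ≤-reflexive; +-mono-≤; +-monoʳ-≤; m≤n+m; +-suc)
open import Data.Bool using (Bool; true; false; _xor_; if_then_else_)
open import Data.Bool.Properties using (xor-same; xor-comm)
open import Data.Fin using (Fin; zero; suc)
open import Data.Vec using (Vec; []; _∷_; lookup; _[_]≔_)
open import Data.Vec.Properties using (lookup∘tabulate; lookup∘updateAt; updateAt-id-local)
open import Data.List using (List)
open import Data.List.Relation.Unary.All using (All)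
import Data.List.Relation.Unary.All as All
open import Data.Product using (∃; _×_; _,_; proj₂)
open import Data.Sum using (_⊎_; inj₁; inj₂)
open import Data.Unit using (⊤; tt)
open import Function using (_∘_)
open import Relation.Binary.PropositionalEquality
  using (_≡_; refl; sym; trans; cong; cong₂; subst)

AboveProjection : ∀ {n} → BoolFun n → Fin n → Set
AboveProjection {n} f i = ∀ (x : Vec Bool n) → lookup x i ≡ true → f x ≡ true

contraposition-Bool : ∀ {b c : Bool} → (b ≡ false → c ≡ false) → c ≡ true → b ≡ true
contraposition-Bool {true}          _ _ = refl
contraposition-Bool {false} {true}  h _ = sym (h refl)

zeroSeparating⇒aboveProjection : ∀ {n} {g : BoolFun n} → ZeroSeparating g →
                                 ∃ (AboveProjection g)
zeroSeparating⇒aboveProjection (j , sep) = j , λ x xⱼ≡1 → contraposition-Bool (sep x) xⱼ≡1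

eval-aboveProjection : ∀ {B n} → All (ZeroSeparating ∘ proj₂) B →
                       (t : Term B n) → ∃ (AboveProjection (eval t))
eval-aboveProjection sep (var i) = i , λ _ xᵢ≡1 → xᵢ≡1
eval-aboveProjection sep (app g∈B ts)
  with zeroSeparating⇒aboveProjection (All.lookup sep g∈B)
... | j , g≥xⱼ with eval-aboveProjection sep (ts j)
...   | i , tⱼ≥xᵢ = i , λ x xᵢ≡1 →
  g≥xⱼ _ (trans (lookup∘tabulate (λ l → eval (ts l) x) j) (tⱼ≥xᵢ x xᵢ≡1))

inClone-aboveProjection : ∀ {B n} {f : BoolFun n} → All (ZeroSeparating ∘ proj₂) B →
                          InClone B f → ∃ (AboveProjection f)
inClone-aboveProjection sep (t , f≗t) with eval-aboveProjection sep t
... | i , t≥xᵢ = i , λ x xᵢ≡1 → trans (f≗t x) (t≥xᵢ x xᵢ≡1)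

Between : ∀ {n} → Vec Bool n → Vec Bool n → Vec Bool n → Set
Between []      []      []      = ⊤
Between (x ∷ a) (y ∷ b) (z ∷ c) = (z ≡ x ⊎ z ≡ y) × Between a b c

between-left : ∀ {n} (a b : Vec Bool n) → Between a b a
between-left []      []      = tt
between-left (x ∷ a) (y ∷ b) = inj₁ refl , between-left a b

between-lookup-true : ∀ {n} (i : Fin n) {a b c : Vec Bool n} → Between a b c →
                      lookup a i ≡ true → lookup b i ≡ true → lookup c i ≡ true
between-lookup-true zero    {_ ∷ _} {_ ∷ _} {_ ∷ _} (inj₁ z≡x , _) x≡1 _   = trans z≡x x≡1
between-lookup-true zero    {_ ∷ _} {_ ∷ _} {_ ∷ _} (inj₂ z≡y , _) _   y≡1 = trans z≡y y≡1
between-lookup-true (suc i) {_ ∷ _} {_ ∷ _} {_ ∷ _} (_ , btw)      = between-lookup-true i btw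

hamming-self : ∀ {n} (a : Vec Bool n) → hamming a a ≡ 0
hamming-self []          = refl
hamming-self (true  ∷ a) = hamming-self a
hamming-self (false ∷ a) = hamming-self a

hamming-comm : ∀ {n} (a b : Vec Bool n) → hamming a b ≡ hamming b a
hamming-comm []      []      = refl
hamming-comm (x ∷ a) (y ∷ b) =
  cong₂ _+_ (cong (if_then 1 else 0) (xor-comm x y)) (hamming-comm a b)

hamming-[]≔ : ∀ {n} (a b : Vec Bool n) (i : Fin n) (v : Bool) →
              hamming (a [ i ]≔ v) (b [ i ]≔ v) ≤ hamming a b
hamming-[]≔ (x ∷ a) (y ∷ b) zero    v rewrite xor-same v = m≤n+m (hamming a b) _
hamming-[]≔ (x ∷ a) (y ∷ b) (suc i) v = +-monoʳ-≤ (if x xor y then 1 else 0) (hamming-[]≔ a b i v)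

adjacent-[]≔-true : ∀ {n} (a : Vec Bool n) (i : Fin n) → lookup a i ≡ false →
                    Adjacent a (a [ i ]≔ true)
adjacent-[]≔-true (x     ∷ a) zero    refl  = cong suc (hamming-self a)
adjacent-[]≔-true (true  ∷ a) (suc i) aᵢ≡0 = adjacent-[]≔-true a i aᵢ≡0
adjacent-[]≔-true (false ∷ a) (suc i) aᵢ≡0 = adjacent-[]≔-true a i aᵢ≡0

module _ {n} {f : BoolFun n} where

  _++ʷ_ : ∀ {a b c l m} → Walk f a b l → Walk f b c m → Walk f a c (l + m)
  here             ++ʷ w = w
  step adj fc≡1 v ++ʷ w = step adj fc≡1 (v ++ʷ w)

  DistLe-trans : ∀ {a b c l m} → DistLe f a b l → DistLe f b c m → DistLe f a c (l + m)
  DistLe-trans (l , v , l≤) (m , w , m≤) = l + m , v ++ʷ w , +-mono-≤ l≤ m≤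

  DistLe-mono : ∀ {a b l m} → l ≤ m → DistLe f a b l → DistLe f a b m
  DistLe-mono l≤m (k , w , k≤l) = k , w , ≤-trans k≤l l≤m

walk-∷ : ∀ {n} {F : BoolFun (suc n)} (x : Bool) {a b ℓ} →
         Walk (F ∘ (x ∷_)) a b ℓ → Walk F (x ∷ a) (x ∷ b) ℓ
walk-∷ x here = here
walk-∷ x {a} (step {c = c} adj fc≡1 w) = step (trans (hamming-∷ x a c) adj) fc≡1 (walk-∷ x w)
  where
    hamming-∷ : ∀ {n} x (a c : Vec Bool n) → hamming (x ∷ a) (x ∷ c) ≡ hamming a c
    hamming-∷ true  _ _ = refl
    hamming-∷ false _ _ = refl

walk-head : ∀ {n} {F : BoolFun (suc n)} (x y : Bool) (a : Vec Bool n) →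
            F (y ∷ a) ≡ true → Walk F (x ∷ a) (y ∷ a) (if x xor y then 1 else 0)
walk-head true  true  a _   = here
walk-head false false a _   = here
walk-head true  false a F≡1 = step (cong suc (hamming-self a)) F≡1 here
walk-head false true  a F≡1 = step (cong suc (hamming-self a)) F≡1 here

interval-walk : ∀ {n} (F : BoolFun n) (a b : Vec Bool n) →
                (∀ c → Between a b c → F c ≡ true) → Walk F a b (hamming a b)
interval-walk F []      []      _ = here
interval-walk F (x ∷ a) (y ∷ b) F≡1 =
  walk-head x y a (F≡1 (y ∷ a) (inj₂ refl , between-left a b))
    ++ʷ walk-∷ y (interval-walk (F ∘ (y ∷_)) a b (λ c btw → F≡1 (y ∷ c) (inj₂ refl , btw)))

module _ {n} {f : BoolFun n} {i : Fin n} (f≥xᵢ : AboveProjection f i) where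

  dist-raise : ∀ a → DistLe f a (a [ i ]≔ true) 1
  dist-raise a with lookup a i in aᵢ
  ... | true  = 0 , subst (λ c → Walk f a c 0) (sym (updateAt-id-local i a (sym aᵢ))) here , z≤n
  ... | false = 1 , step (adjacent-[]≔-true a i aᵢ) (f≥xᵢ _ (lookup∘updateAt i a)) here , ≤-refl

  dist-lower : ∀ b → f b ≡ true → DistLe f (b [ i ]≔ true) b 1
  dist-lower b fb≡1 with lookup b i in bᵢ
  ... | true  = 0 , subst (λ c → Walk f c b 0) (sym (updateAt-id-local i b (sym bᵢ))) here , z≤n
  ... | false = 1 , step adj fb≡1 here , ≤-refl
    where
      adj : Adjacent (b [ i ]≔ true) b
      adj = trans (hamming-comm (b [ i ]≔ true) b) (adjacent-[]≔-true b i bᵢ)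

  dist-raised : ∀ a b → DistLe f (a [ i ]≔ true) (b [ i ]≔ true) (hamming a b)
  dist-raised a b = _ , interval-walk f a′ b′ inside , hamming-[]≔ a b i true
    where
      a′ b′ : Vec Bool n
      a′ = a [ i ]≔ true
      b′ = b [ i ]≔ true
      inside : ∀ c → Between a′ b′ c → f c ≡ true
      inside c btw = f≥xᵢ c (between-lookup-true i btw (lookup∘updateAt i a) (lookup∘updateAt i b))

  aboveProjection-dist : ∀ a b → f b ≡ true → DistLe f a b (hamming a b + 2)
  aboveProjection-dist a b fb≡1 =
    DistLe-mono (≤-reflexive (sym (+-suc (hamming a b) 1)))
      (DistLe-trans (dist-raise a) (DistLe-trans (dist-raised a b) (dist-lower b fb≡1)))

lemma4p4 : (B : List AnyFun) → All (λ g → ZeroSeparating (proj₂ g)) B →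
    ∀ {n} (f : BoolFun n) → InClone B f →
      Connected f ×
      (∀ (a b : Vec Bool n) → f a ≡ true → f b ≡ true → DistLe f a b (hamming a b + 2))
lemma4p4 B sep f f∈[B] with inClone-aboveProjection sep f∈[B]
... | i , f≥xᵢ = connected , dist
  where
    dist : ∀ a b → f a ≡ true → f b ≡ true → DistLe f a b (hamming a b + 2)
    dist a b _ fb≡1 = aboveProjection-dist f≥xᵢ a b fb≡1

    connected : Connected f
    connected a b fa≡1 fb≡1 with dist a b fa≡1 fb≡1
    ... | ℓ , w , _ = ℓ , w
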